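{- There is a deterministic distributed algorithm in the CONGEST model that runs in two rounds and computes a $(2,2)$-edge-kernel of the input graph $G$.
   Context: CONGEST model: the network is an $n$-node graph $G=(V,E)$; each node has a unique $O(\log n)$-bit ID; in each synchronous round every node may send a message of $O(\log n)$ bits to each neighbor and perform unbounded local computation. The distance $\mathrm{dist}_G(e,f)$ between two edges is their distance in the line graph of $G$. For $F\subseteq E$, $G[F]=(V,F)$. A $(d,r)$-edge-kernel of $G$ is a set $F\subseteq E$ such that $G[F]$ has maximum degree at most $d$ and for every $e\in E$ there is $f\in F$ with $\mathrm{dist}_G(e,f)\leq r$. -}

module Defs where

open import Data.Nat using (ℕ; zero; suc; _+_; _^_; _<_; _≤_)
open import Data.Fin using (Fin; _≟_)
open import Data.Bool using (Bool; true; false; if_then_else_; _∧_; _∨_)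
open import Data.List using (List; []; _∷_; length; map; take; allFin)
open import Data.Nat.ListAction using (sum)
open import Data.List.Relation.Unary.All using (All)
open import Data.List.Relation.Unary.Unique.Propositional using (Unique)
open import Data.List.Membership.Propositional using (_∈_)
open import Data.Product using (Σ; _×_; _,_)
open import Data.Sum using (_⊎_)
open import Relation.Binary.PropositionalEquality using (_≡_)
open import Relation.Nullary using (yes; no)
open import Function.Definitions using (Injective)

record Graph (n : ℕ) : Set where
  field
    adj    : Fin n → Fin n → Bool
    sym    : ∀ u v → adj u v ≡ adj v u
    irrefl : ∀ v → adj v v ≡ false
open Graph public

IsEdge : ∀ {n} → Graph n → Fin n × Fin n → Set
IsEdge G (u , v) = adj G u v ≡ true

countTrue : ∀ {n} → (Fin n → Bool) → ℕ
countTrue {n} p = sum (map (λ u → if p u then 1 else 0) (allFin n))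

-- Distance in the line graph (bounded): Within G r e f  iff  dist_G(e,f) ≤ r
-- (for edges e, f of G).  Two edges are adjacent in the line graph iff they
-- share an endpoint.

ShareEnd : ∀ {n} → Fin n × Fin n → Fin n × Fin n → Set
ShareEnd (a , b) (c , d) = (a ≡ c ⊎ a ≡ d) ⊎ (b ≡ c ⊎ b ≡ d)

data Within {n} (G : Graph n) : ℕ → Fin n × Fin n → Fin n × Fin n → Set where
  here : ∀ {r e} → Within G r e e
  step : ∀ {r e g f} → IsEdge G g → ShareEnd e g → Within G r g f → Within G (suc r) e f

-- (d,r)-edge-kernel.  F ⊆ E is given as a symmetric Boolean predicate on
-- ordered pairs ({u,v} ∈ F iff F u v ≡ true).

record IsEdgeKernel {n} (G : Graph n) (d r : ℕ) (F : Fin n → Fin n → Bool) : Set where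
  field
    subset : ∀ u v → F u v ≡ true → adj G u v ≡ true
    symF   : ∀ u v → F u v ≡ F v u
    degree : ∀ v → countTrue (F v) ≤ d
    cover  : ∀ a b → adj G a b ≡ true →
             Σ (Fin n) λ c → Σ (Fin n) λ e → F c e ≡ true × Within G r (a , b) (c , e)

-- Port numberings: node v sees its neighbours through ports 0 .. deg v - 1,
-- ports v lists the neighbour behind each port (each neighbour exactly once).

record PortNumbering {n} (G : Graph n) : Set where
  field
    ports    : Fin n → List (Fin n)
    unique   : ∀ v → Unique (ports v)
    complete : ∀ v u → u ∈ ports v → adj G v u ≡ true
    sound    : ∀ v u → adj G v u ≡ true → u ∈ ports v
open PortNumbering public

deg : ∀ {n} {G : Graph n} → PortNumbering G → Fin n → ℕ
deg P v = length (ports P v)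

nth : ∀ {A : Set} → List A → ℕ → A → A
nth []       _       a = a
nth (x ∷ xs) zero    a = x
nth (x ∷ xs) (suc i) a = nth xs i a

-- port index of u in a port list (length of list if absent)
indexOf : ∀ {n} → Fin n → List (Fin n) → ℕ
indexOf u [] = zero
indexOf u (x ∷ xs) with u ≟ x
... | yes _ = zero
... | no  _ = suc (indexOf u xs)

-- In each round it
-- sends a list of messages (the i-th goes out on port i; missing entries
-- are 0), then receives the list of incoming messages (the i-th arrived on
-- port i) and updates its state.  After the last round it outputs a list of
-- Booleans: the i-th says whether the edge on port i is put into F.
-- Local computation is unrestricted (any Agda function).  Messages are
-- natural numbers; the O(log n)-bit bound is imposed in CONGEST below.

record Algorithm : Set₁ where
  field
    State : Set
    init  : (n : ℕ) → (myId : ℕ) → (degree : ℕ) → State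
    send  : State → List ℕ
    recv  : State → List ℕ → State
    out   : State → List Bool
open Algorithm public

module Run (A : Algorithm) {n : ℕ} (G : Graph n) (P : PortNumbering G)
           (ids : Fin n → ℕ) where

  -- message delivered to v on its port towards u
  incoming : (Fin n → State A) → Fin n → List ℕ
  incoming st v = map (λ u → nth (send A (st u)) (indexOf v (ports P u)) 0) (ports P v)

  stateAt : ℕ → Fin n → State A
  stateAt zero    v = init A n (ids v) (deg P v)
  stateAt (suc r) v = recv A (stateAt r v) (incoming (stateAt r) v)

  -- messages actually put on the edges in round r+1 by node v
  sentAt : ℕ → Fin n → List ℕ
  sentAt r v = take (deg P v) (send A (stateAt r v))

  selects : ℕ → Fin n → Fin n → Bool
  selects t v u = nth (out A (stateAt t v)) (indexOf u (ports P v)) false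

  outputF : ℕ → Fin n → Fin n → Bool
  outputF t u v = adj G u v ∧ (selects t u v ∨ selects t v u)

-- Every message sent within the first t rounds has O(log n) bits,
-- i.e. is < (n+2)^B.
MessagesBounded : (A : Algorithm) → ℕ → ℕ → {n : ℕ} → (G : Graph n) →
                  PortNumbering G → (Fin n → ℕ) → Set
MessagesBounded A B t {n} G P ids =
  ∀ r → r < t → ∀ v → All (λ m → m < (n + 2) ^ B) (Run.sentAt A G P ids r v)

-- Valid ID assignments: distinct IDs of O(log n) bits, i.e. < (n+2)^c.
ValidIds : (c n : ℕ) → (Fin n → ℕ) → Set
ValidIds c n ids = Injective _≡_ _≡_ ids × (∀ v → ids v < (n + 2) ^ c)

CongestEdgeKernelAlg : (c t d r : ℕ) → Algorithm → Set
CongestEdgeKernelAlg c t d r A =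
  Σ ℕ λ B → ∀ (n : ℕ) (G : Graph n) (P : PortNumbering G) (ids : Fin n → ℕ) →
    ValidIds c n ids →
    MessagesBounded A B t G P ids × IsEdgeKernel G d r (Run.outputF A G P ids t)

-- Every node proposes the edge on its first port and accepts only the first proposal it
-- receives; F consists of the accepted edges.  A node v lies on at most two edges of F:
-- the one it accepted, and the one on its first port (the only edge along which v
-- proposed).  For an edge ab, a proposed to its first neighbour x, so x accepted some
-- edge xy, and ab, ax, xy is a path of length 2 in the line graph.  One round suffices;
-- the second round repeats the first.
module Submission where

open import Defs hiding (sym)
open import Data.Bool using (Bool; true; false; if_then_else_; _∧_; _∨_)
open import Data.Bool.Properties using (∨-comm)
open import Data.Empty using (⊥-elim)
open import Data.Fin using (Fin; _≟_)
open import Data.List using (List; []; _∷_; map; allFin)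
open import Data.List.Properties using (map-id)
open import Data.List.Membership.Propositional using (_∈_)
open import Data.List.Relation.Unary.All using (All; []; _∷_)
open import Data.List.Relation.Unary.All.Properties using (take⁺)
open import Data.List.Relation.Unary.AllPairs using ([]; _∷_)
open import Data.List.Relation.Unary.Any using (here; there)
open import Data.List.Relation.Unary.Unique.Propositional using (Unique)
open import Data.List.Relation.Unary.Unique.Propositional.Properties using (allFin⁺)
open import Data.Nat using (ℕ; zero; suc; _+_; _^_; _<_; _≤_; z≤n; s≤s)
open import Data.Nat.ListAction using (sum)
open import Data.Nat.Properties using (+-commutativeSemigroup; ≤-trans; ≤-reflexive; +-mono-≤; m≤n+m; ^-identityʳ; <-irrefl)
open import Algebra.Properties.CommutativeSemigroup +-commutativeSemigroup using (interchange)
open import Data.Product using (Σ; _×_; _,_; proj₁; proj₂)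
open import Data.Sum using (_⊎_; inj₁; inj₂)
open import Relation.Binary.PropositionalEquality using (_≡_; _≢_; refl; sym; trans; cong; subst)
open import Relation.Nullary using (yes; no; does)

module _ {n : ℕ} where

  indexOf-head : (x : Fin n) (xs : List (Fin n)) → indexOf x (x ∷ xs) ≡ 0
  indexOf-head x xs with x ≟ x
  ... | yes _  = refl
  ... | no x≢x = ⊥-elim (x≢x refl)

  indexOf-tail : {y z : Fin n} (zs : List (Fin n)) → y ≢ z → indexOf y (z ∷ zs) ≡ suc (indexOf y zs)
  indexOf-tail {y} {z} zs y≢z with y ≟ z
  ... | yes y≡z = ⊥-elim (y≢z y≡z)
  ... | no _    = refl

  nth-map-indexOf : {A : Set} (f : Fin n → A) {u : Fin n} (xs : List (Fin n)) (d : A) →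
                    u ∈ xs → nth (map f xs) (indexOf u xs) d ≡ f u
  nth-map-indexOf f {u} (x ∷ xs) d u∈ with u ≟ x
  ... | yes refl = refl
  nth-map-indexOf f (x ∷ xs) d (here u≡x)  | no u≢x = ⊥-elim (u≢x u≡x)
  nth-map-indexOf f (x ∷ xs) d (there u∈) | no _   = nth-map-indexOf f xs d u∈

  nth-indexOf : {u : Fin n} (xs : List (Fin n)) (d : Fin n) → u ∈ xs → nth xs (indexOf u xs) d ≡ u
  nth-indexOf {u} xs d u∈ =
    subst (λ ys → nth ys (indexOf u xs) d ≡ u) (map-id xs) (nth-map-indexOf (λ x → x) xs d u∈)
  count : (Fin n → Bool) → List (Fin n) → ℕ
  count p xs = sum (map (λ u → if p u then 1 else 0) xs)

  count-≤-∨ : (p q r : Fin n → Bool) → (∀ u → p u ≡ true → q u ≡ true ⊎ r u ≡ true) →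
              (xs : List (Fin n)) → count p xs ≤ count q xs + count r xs
  count-≤-∨ p q r p⇒q∨r []       = z≤n
  count-≤-∨ p q r p⇒q∨r (x ∷ xs) = ≤-trans
    (+-mono-≤ (indicator-≤ (p x) (q x) (r x) (p⇒q∨r x)) (count-≤-∨ p q r p⇒q∨r xs))
    (≤-reflexive (interchange (if q x then 1 else 0) (if r x then 1 else 0) (count q xs) (count r xs)))
    where
    indicator-≤ : ∀ a b c → (a ≡ true → b ≡ true ⊎ c ≡ true) →
                  (if a then 1 else 0) ≤ (if b then 1 else 0) + (if c then 1 else 0)
    indicator-≤ false b c _ = z≤n
    indicator-≤ true  b c a⇒b∨c with a⇒b∨c refl
    ... | inj₁ refl = s≤s z≤n
    ... | inj₂ refl = m≤n+m 1 (if b then 1 else 0)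

  isEqual : Fin n → Fin n → Bool
  isEqual x u = does (u ≟ x)

  isEqual-refl : (x : Fin n) → isEqual x x ≡ true
  isEqual-refl x with x ≟ x
  ... | yes _  = refl
  ... | no x≢x = ⊥-elim (x≢x refl)

  count-isEqual-∉ : (x : Fin n) (xs : List (Fin n)) → All (x ≢_) xs → count (isEqual x) xs ≡ 0
  count-isEqual-∉ x []       []           = refl
  count-isEqual-∉ x (y ∷ ys) (x≢y ∷ x∉ys) with y ≟ x
  ... | yes y≡x = ⊥-elim (x≢y (sym y≡x))
  ... | no _    = count-isEqual-∉ x ys x∉ys

  count-isEqual-≤1 : (x : Fin n) (xs : List (Fin n)) → Unique xs → count (isEqual x) xs ≤ 1
  count-isEqual-≤1 x []       []             = z≤n
  count-isEqual-≤1 x (y ∷ ys) (y∉ys ∷ unique) with y ≟ x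
  ... | yes refl = ≤-reflexive (cong suc (count-isEqual-∉ y ys y∉ys))
  ... | no _     = count-isEqual-≤1 x ys unique

  countTrue-≤2 : (p : Fin n → Bool) (x y : Fin n) → (∀ u → p u ≡ true → u ≡ x ⊎ u ≡ y) → countTrue p ≤ 2
  countTrue-≤2 p x y p⇒x∨y = ≤-trans
    (count-≤-∨ p (isEqual x) (isEqual y) p⇒x∨y′ (allFin n))
    (+-mono-≤ (count-isEqual-≤1 x (allFin n) (allFin⁺ n)) (count-isEqual-≤1 y (allFin n) (allFin⁺ n)))
    where
    p⇒x∨y′ : ∀ u → p u ≡ true → isEqual x u ≡ true ⊎ isEqual y u ≡ true
    p⇒x∨y′ u pu with p⇒x∨y u pu
    ... | inj₁ refl = inj₁ (isEqual-refl u)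
    ... | inj₂ refl = inj₂ (isEqual-refl u)

markFirstPositive : List ℕ → List Bool
markFirstPositive []           = []
markFirstPositive (zero  ∷ ms) = false ∷ markFirstPositive ms
markFirstPositive (suc _ ∷ ms) = true ∷ map (λ _ → false) ms

firstPositiveIndex : List ℕ → ℕ
firstPositiveIndex []           = 0
firstPositiveIndex (zero  ∷ ms) = suc (firstPositiveIndex ms)
firstPositiveIndex (suc _ ∷ ms) = 0

nth-map-false : ∀ {A : Set} (xs : List A) i → nth (map (λ _ → false) xs) i false ≢ true
nth-map-false []       i       ()
nth-map-false (x ∷ xs) zero    ()
nth-map-false (x ∷ xs) (suc i) marked = nth-map-false xs i marked

markFirstPositive-true : ∀ ms i → nth (markFirstPositive ms) i false ≡ true →
                         i ≡ firstPositiveIndex ms × 0 < nth ms i 0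
markFirstPositive-true (zero  ∷ ms) (suc i) marked with markFirstPositive-true ms i marked
... | i≡first , positive = cong suc i≡first , positive
markFirstPositive-true (suc m ∷ ms) zero    marked = refl , s≤s z≤n
markFirstPositive-true (suc m ∷ ms) (suc i) marked = ⊥-elim (nth-map-false ms i marked)

markFirstPositive-hits : ∀ {n} (f : Fin n → ℕ) (xs : List (Fin n)) {w : Fin n} → w ∈ xs → 0 < f w →
                         Σ (Fin n) λ y → y ∈ xs × 0 < f y ×
                         nth (markFirstPositive (map f xs)) (indexOf y xs) false ≡ true
markFirstPositive-hits f (x ∷ xs) w∈ 0<fw with f x in fx≡
... | suc m = x , here refl , subst (0 <_) (sym fx≡) (s≤s z≤n) ,
              subst (λ i → nth (true ∷ map (λ _ → false) (map f xs)) i false ≡ true)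
                    (sym (indexOf-head x xs)) refl
markFirstPositive-hits f (x ∷ xs) (here refl) 0<fw | zero = ⊥-elim (<-irrefl refl (subst (0 <_) fx≡ 0<fw))
markFirstPositive-hits f (x ∷ xs) (there w∈) 0<fw | zero with markFirstPositive-hits f xs w∈ 0<fw
... | y , y∈ , 0<fy , marked =
  y , there y∈ , 0<fy ,
  subst (λ i → nth (false ∷ markFirstPositive (map f xs)) i false ≡ true) (sym (indexOf-tail xs y≢x)) marked
  where
  y≢x : y ≢ x
  y≢x refl = <-irrefl refl (subst (0 <_) fx≡ 0<fy)

-- The message 1 on port 0 is the proposal; all other ports carry the default 0.
acceptFirstProposal : Algorithm
acceptFirstProposal = record
  { State = List ℕ
  ; init  = λ _ _ _ → []
  ; send  = λ _ → 1 ∷ []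
  ; recv  = λ _ received → received
  ; out   = markFirstPositive
  }

∧-∨-true : ∀ a b c → a ∧ (b ∨ c) ≡ true → a ≡ true × (b ≡ true ⊎ c ≡ true)
∧-∨-true true true  c    _ = refl , inj₁ refl
∧-∨-true true false true _ = refl , inj₂ refl

proposal-only-on-port-0 : ∀ i → 0 < nth (1 ∷ []) i 0 → i ≡ 0
proposal-only-on-port-0 zero _ = refl

module _ {n : ℕ} (G : Graph n) (P : PortNumbering G) (ids : Fin n → ℕ) where
  open Run acceptFirstProposal G P ids

  proposalTo : Fin n → Fin n → ℕ
  proposalTo v u = nth (1 ∷ []) (indexOf v (ports P u)) 0

  received : Fin n → List ℕ
  received v = map (proposalTo v) (ports P v)

  firstNeighbour acceptedNeighbour : Fin n → Fin n
  firstNeighbour    v = nth (ports P v) 0 v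
  acceptedNeighbour v = nth (ports P v) (firstPositiveIndex (received v)) v

  F : Fin n → Fin n → Bool
  F = outputF 2

  adj-sym : ∀ {u v} → adj G u v ≡ true → adj G v u ≡ true
  adj-sym {u} {v} uv = trans (Graph.sym G v u) uv

  accepts⇒acceptedNeighbour : ∀ v u → adj G v u ≡ true → selects 2 v u ≡ true → u ≡ acceptedNeighbour v
  accepts⇒acceptedNeighbour v u vu accepted =
    trans (sym (nth-indexOf (ports P v) v (sound P v u vu)))
          (cong (λ i → nth (ports P v) i v) (proj₁ (markFirstPositive-true (received v) _ accepted)))

  accepted⇒firstNeighbour : ∀ v u → adj G v u ≡ true → selects 2 u v ≡ true → u ≡ firstNeighbour v
  accepted⇒firstNeighbour v u vu accepted =
    trans (sym (nth-indexOf (ports P v) v (sound P v u vu)))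
          (cong (λ i → nth (ports P v) i v) (proposal-only-on-port-0 _ proposed))
    where
    proposed : 0 < proposalTo u v
    proposed = subst (0 <_) (nth-map-indexOf (proposalTo u) (ports P u) 0 (sound P u v (adj-sym vu)))
                     (proj₂ (markFirstPositive-true (received u) (indexOf v (ports P u)) accepted))

  accepts⇒F : ∀ v u → adj G v u ≡ true → selects 2 v u ≡ true → F v u ≡ true
  accepts⇒F v u vu accepted rewrite vu | accepted = refl

  first-port-proposed : ∀ {a x xs} → ports P a ≡ x ∷ xs → 0 < proposalTo x a
  first-port-proposed {x = x} {xs} pa rewrite pa | indexOf-head x xs = s≤s z≤n

  F-sym : ∀ u v → F u v ≡ F v u
  F-sym u v rewrite Graph.sym G u v | ∨-comm (selects 2 u v) (selects 2 v u) = refl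

  F-degree-≤2 : ∀ v → countTrue (F v) ≤ 2
  F-degree-≤2 v = countTrue-≤2 (F v) (firstNeighbour v) (acceptedNeighbour v) F-neighbours
    where
    F-neighbours : ∀ u → F v u ≡ true → u ≡ firstNeighbour v ⊎ u ≡ acceptedNeighbour v
    F-neighbours u Fvu with ∧-∨-true (adj G v u) (selects 2 v u) (selects 2 u v) Fvu
    ... | vu , inj₁ v-accepts = inj₂ (accepts⇒acceptedNeighbour v u vu v-accepts)
    ... | vu , inj₂ u-accepts = inj₁ (accepted⇒firstNeighbour v u vu u-accepts)

  F-covers : ∀ a b → adj G a b ≡ true →
             Σ (Fin n) λ c → Σ (Fin n) λ e → F c e ≡ true × Within G 2 (a , b) (c , e)
  F-covers a b ab with ports P a in pa | sound P a b ab
  ... | x ∷ xs | _ = x , y , accepts⇒F x y xy x-accepts ,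
                     step ax (inj₁ (inj₁ refl)) (step xy (inj₂ (inj₁ refl)) here)
    where
    ax : adj G a x ≡ true
    ax = complete P a x (subst (x ∈_) (sym pa) (here refl))

    x-hears : Σ (Fin n) λ y → y ∈ ports P x × 0 < proposalTo x y × selects 2 x y ≡ true
    x-hears = markFirstPositive-hits (proposalTo x) (ports P x) (sound P x a (adj-sym ax))
                                     (first-port-proposed pa)

    y : Fin n
    y = proj₁ x-hears

    xy : adj G x y ≡ true
    xy = complete P x y (proj₁ (proj₂ x-hears))

    x-accepts : selects 2 x y ≡ true
    x-accepts = proj₂ (proj₂ (proj₂ x-hears))

  F-isEdgeKernel : IsEdgeKernel G 2 2 F
  F-isEdgeKernel = record
    { subset = λ u v Fuv → proj₁ (∧-∨-true (adj G u v) (selects 2 u v) (selects 2 v u) Fuv)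
    ; symF   = F-sym
    ; degree = F-degree-≤2
    ; cover  = F-covers
    }

proposals-bounded : ∀ {n} (G : Graph n) (P : PortNumbering G) (ids : Fin n → ℕ) →
                    MessagesBounded acceptFirstProposal 1 2 G P ids
proposals-bounded {n} G P ids _ _ v = take⁺ (deg P v) (1<[n+2]^1 ∷ [])
  where
  1<[n+2]^1 : 1 < (n + 2) ^ 1
  1<[n+2]^1 = subst (1 <_) (sym (^-identityʳ (n + 2))) (m≤n+m 2 n)

lemma11 : (c : ℕ) → Σ Algorithm λ A → CongestEdgeKernelAlg c 2 2 2 A
lemma11 c = acceptFirstProposal , 1 , λ n G P ids _ → proposals-bounded G P ids , F-isEdgeKernel G P ids
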